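{- Let $m\ge3$ be an odd integer and $\Gamma=C_{2m}\square C_{2m}$. If $\Gamma$ admits a distance magic labeling and $L$ is the $2m\times 2m$ table corresponding to a distance magic labeling of $\Gamma$, then the pair of tables $par(L)$ is distance magic. Conversely, if a pair $\langle T,T'\rangle$ of $m\times m$ tables is distance magic, then $mer(T,T')$ corresponds to a distance magic labeling of $\Gamma$, and consequently $\Gamma$ is distance magic.
   Context: $\mathcal{N}_N=\{1-N,3-N,\ldots,N-1\}$. A distance magic labeling of a graph of order $N$ is a bijection $\ell:V\to\mathcal{N}_N$ such that every vertex has neighbour-label sum $0$. $C_{2m}\square C_{2m}$ is the Cayley graph of $\mathbb{Z}_{2m}\times\mathbb{Z}_{2m}$ with connection set $\{\pm(1,0),\pm(0,1)\}$; a labeling $\ell$ is represented by the $2m\times2m$ table $L=[\ell_{i,j}]$, $\ell_{i,j}=\ell((i,j))$, indices modulo $2m$; indices of $m\times m$ tables are modulo $m$. For a $2m\times 2m$ table $L$, $par(L)=\langle T,T'\rangle$ where $T=[t_{i,j}]$, $T'=[t'_{i,j}]$ are $m\times m$ tables with $t_{i,j}=\ell_{2i,2j}$ and $t'_{i,j}=\ell_{2i+1,2j}$. For $m\times m$ tables $T,T'$, $mer(T,T')$ is the $2m\times2m$ table $[\ell_{i,j}]$ with $\ell_{i,j}=t_{i/2,j/2}$ if $i,j$ even; $-t_{(i+m)/2,(j+m)/2}$ if $i,j$ odd; $t'_{(i-1)/2,j/2}$ if $i$ odd, $j$ even; $-t'_{(i+m-1)/2,(j+m)/2}$ if $i$ even,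 $j$ odd. A pair $\langle T,T'\rangle$ of $m\times m$ tables is distance magic if for each $k\in\mathcal{N}_{4m^2}$ exactly one of $k,-k$ appears among the entries of $T$ and $T'$ together, and for all $0\le i,j<m$: $t_{i-1,j}+t_{i,j}=t_{i+\frac{m-1}{2},j+\frac{m-1}{2}}+t_{i+\frac{m-1}{2},j+\frac{m+1}{2}}$ and $t'_{i-1,j}+t'_{i,j}=t'_{i+\frac{m-1}{2},j+\frac{m-1}{2}}+t'_{i+\frac{m-1}{2},j+\frac{m+1}{2}}$. -}

module Defs where

open import Data.Nat using (ℕ; zero; suc; _+_; _*_; _∸_; _/_; _%_)
open import Data.Nat.DivMod using (m%n<n)
open import Data.Fin using (Fin; toℕ; fromℕ<)
open import Data.Integer using (ℤ; +_; _-_; -_; 0ℤ)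
import Data.Integer as ℤ
open import Data.Product using (Σ; ∃; ∃₂; _×_; _,_; proj₁; proj₂)
open import Data.Sum using (_⊎_)
open import Relation.Nullary using (¬_)
open import Relation.Binary.PropositionalEquality using (_≡_)

Table : ℕ → Set
Table n = Fin n → Fin n → ℤ

-- Access with indices taken modulo n (n = 0 never occurs; returns 0 then).
at : ∀ {n} → Table n → ℕ → ℕ → ℤ
at {zero}  L i j = 0ℤ
at {suc n} L i j = L (fromℕ< (m%n<n i (suc n))) (fromℕ< (m%n<n j (suc n)))

-- The j-th element of 𝒩_N = {1-N, 3-N, ..., N-1}: namely 1 - N + 2j.
nlab : (N : ℕ) → Fin N → ℤ
nlab N j = + (2 * toℕ j + 1) - + N

InN : ℕ → ℤ → Set
InN N k = ∃ λ (j : Fin N) → k ≡ nlab N j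

-- A distance magic labeling of C_{2m} □ C_{2m} given as its 2m×2m table L:
-- L is a bijection from vertices Z_{2m}×Z_{2m} onto 𝒩_{4m²}, and every
-- vertex has neighbour-label sum 0 (neighbours ±(1,0), ±(0,1), mod 2m).
IsDistanceMagicLabeling : (m : ℕ) → Table (2 * m) → Set
IsDistanceMagicLabeling m L =
  (∀ i j → InN N (L i j))
  × (∀ i j i' j' → L i j ≡ L i' j' → (i ≡ i') × (j ≡ j'))
  × (∀ k → InN N k → ∃₂ λ i j → L i j ≡ k)
  × (∀ (i j : Fin (2 * m)) →
       let a = toℕ i ; b = toℕ j in
       at L (a + (2 * m ∸ 1)) b ℤ.+ at L (a + 1) b
         ℤ.+ at L a (b + (2 * m ∸ 1)) ℤ.+ at L a (b + 1) ≡ 0ℤ)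
  where N = 4 * (m * m)

CCDistanceMagic : ℕ → Set
CCDistanceMagic m = ∃ λ (L : Table (2 * m)) → IsDistanceMagicLabeling m L

Appears : ∀ {m} → Table m → Table m → ℤ → Set
Appears T T' k = (∃₂ λ i j → T i j ≡ k) ⊎ (∃₂ λ i j → T' i j ≡ k)

IsDistanceMagicPair : (m : ℕ) → Table m → Table m → Set
IsDistanceMagicPair m T T' =
  (∀ k → InN (4 * (m * m)) k →
     (Appears T T' k ⊎ Appears T T' (- k)) × ¬ (Appears T T' k × Appears T T' (- k)))
  × (∀ (i j : Fin m) → cond T (toℕ i) (toℕ j))
  × (∀ (i j : Fin m) → cond T' (toℕ i) (toℕ j))
  where
  cond : Table m → ℕ → ℕ → Set
  cond U i j =
    at U (i + (m ∸ 1)) j ℤ.+ at U i j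
      ≡ at U (i + (m ∸ 1) / 2) (j + (m ∸ 1) / 2) ℤ.+ at U (i + (m ∸ 1) / 2) (j + (m + 1) / 2)

par : (m : ℕ) → Table (2 * m) → Table m × Table m
par m L = (λ i j → at L (2 * toℕ i) (2 * toℕ j))
        , (λ i j → at L (2 * toℕ i + 1) (2 * toℕ j))

merEntry : (m : ℕ) → Table m → Table m → ℕ → ℕ → ℤ
merEntry m T T' i j with i % 2 | j % 2
... | 0 | 0 = at T (i / 2) (j / 2)
... | 1 | 1 = - at T ((i + m) / 2) ((j + m) / 2)
... | 1 | 0 = at T' ((i ∸ 1) / 2) (j / 2)
... | 0 | 1 = - at T' ((i + m ∸ 1) / 2) ((j + m) / 2)
... | _ | _ = 0ℤ  -- unreachable (i % 2, j % 2 ∈ {0,1})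

mer : (m : ℕ) → Table m → Table m → Table (2 * m)
mer m T T' i j = merEntry m T T' (toℕ i) (toℕ j)

-- Read a labelling of C_{2m} □ C_{2m} as a doubly 2m-periodic function f on ℕ × ℕ.
-- Vanishing neighbour sums make u(a,b) = f(a,b+1) + f(a+1,b) change sign along the
-- diagonals, and since m is odd this forces the antipodal law f(a+m,b+m) = -f(a,b).
-- Rewriting the two vertical neighbours of a vertex by this law turns its neighbour
-- condition into the pair condition (a rhombus condition) on the table of par that
-- contains its horizontal neighbours; and v, -v sit at antipodal positions of opposite
-- column parity, so exactly one of them lies on the even columns that par reads.
-- Conversely mer(T,T') is antipodal by construction, the same identity turns the pair
-- conditions into vanishing neighbour sums, and since all (2m)² labels of 𝒩 occur among
-- the (2m)² entries of mer(T,T'), pigeonhole makes it a bijection onto 𝒩.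
module Submission where

open import Defs
open import Data.Fin using (Fin; toℕ; fromℕ<; combine; punchOut)
open import Data.Fin.Properties
  using ( toℕ-fromℕ<; fromℕ<-toℕ; fromℕ<-cong; toℕ<n; toℕ-injective; combine-injective
        ; any?; _≟_; injective⇒≤; punchOut-injective )
open import Data.Integer as ℤ using (ℤ; +_; -_; 0ℤ; _-_)
import Data.Integer.Properties as ℤP
import Data.Integer.Tactic.RingSolver as ℤ-Solver
open import Data.List using (_∷_; [])
open import Data.Nat using (ℕ; zero; suc; _+_; _*_; _∸_; _/_; _%_; _≤_; _<_; z≤n; s≤s; NonZero)
open import Data.Nat.DivMod
  using (m%n<n; [m+kn]%n≡m%n; m<n⇒m%n≡m; m≡m%n+[m/n]*n; /-congˡ; m*n/n≡m; m∣n⇒o%n%m≡o%m; m*n%n≡0)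
open import Data.Nat.Divisibility using (_∣_; m∣m*n)
open import Data.Nat.Properties
  using ( +-suc; +-comm; +-assoc; *-comm; +-cancelʳ-≡; *-cancelˡ-≡; 0≢1+n; 1+n≰n; +-monoˡ-<; *-monoʳ-≤
        ; module ≤-Reasoning )
open import Data.Nat.Tactic.RingSolver using (solve; solve-∀)
open import Data.Product using (∃; ∃₂; _×_; _,_; proj₁; proj₂)
open import Data.Sum using (_⊎_; inj₁; inj₂)
open import Function.Base using (id)
open import Function.Bundles using (_⇔_; mk⇔; Equivalence)
open import Relation.Binary.PropositionalEquality
open import Relation.Nullary using (¬_; yes; no; contradiction)

open import Algebra.Properties.AbelianGroup ℤP.+-0-abelianGroup using (inverseʳ-unique; ∙-cancelʳ)
open import Algebra.Properties.CommutativeSemigroup ℤP.+-commutativeSemigroup using (interchange)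

[1+2k]+[1+2y]≡2[1+k+y] : ∀ k y → (1 + 2 * k) + (1 + 2 * y) ≡ 2 * (1 + k + y)
[1+2k]+[1+2y]≡2[1+k+y] = solve-∀

[1+2k]+2y≡1+2[k+y] : ∀ k y → (1 + 2 * k) + 2 * y ≡ 1 + 2 * (k + y)
[1+2k]+2y≡1+2[k+y] = solve-∀

4[m*m]≡2m*2m : ∀ m → 4 * (m * m) ≡ 2 * m * (2 * m)
4[m*m]≡2m*2m = solve-∀

data Parity : ℕ → Set where
  even : ∀ x → Parity (2 * x)
  odd  : ∀ x → Parity (1 + 2 * x)

parity : ∀ a → Parity a
parity zero = even 0
parity (suc a) with parity a
... | even x = odd x
... | odd x  = subst Parity (2[1+x]≡2+2x x) (even (suc x))
  where
  2[1+x]≡2+2x : ∀ x → 2 * suc x ≡ 2 + 2 * x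
  2[1+x]≡2+2x = solve-∀

a≡2x⇒a/2≡x : ∀ {a} x → a ≡ 2 * x → a / 2 ≡ x
a≡2x⇒a/2≡x x refl = trans (/-congˡ (*-comm 2 x)) (m*n/n≡m x 2)

2x%2≡0 : ∀ x → (2 * x) % 2 ≡ 0
2x%2≡0 x = trans (cong (_% 2) (*-comm 2 x)) (m*n%n≡0 x 2)

[1+2x]%2≡1 : ∀ x → (1 + 2 * x) % 2 ≡ 1
[1+2x]%2≡1 x = trans (cong (λ y → (1 + y) % 2) (*-comm 2 x)) ([m+kn]%n≡m%n 1 x 2)

2y%n≢[1+2z]%n : ∀ {n} .{{_ : NonZero n}} → 2 ∣ n → ∀ y z → (2 * y) % n ≢ (1 + 2 * z) % n
2y%n≢[1+2z]%n {n} 2∣n y z eq = 0≢1+n (begin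
  0                   ≡⟨ 2x%2≡0 y ⟨
  (2 * y) % 2         ≡⟨ m∣n⇒o%n%m≡o%m 2 n (2 * y) 2∣n ⟨
  (2 * y) % n % 2     ≡⟨ cong (_% 2) eq ⟩
  (1 + 2 * z) % n % 2 ≡⟨ m∣n⇒o%n%m≡o%m 2 n (1 + 2 * z) 2∣n ⟩
  (1 + 2 * z) % 2     ≡⟨ [1+2x]%2≡1 z ⟩
  1                   ∎)
  where open ≡-Reasoning

r+2s<2m : ∀ {r s m} → r ≤ 1 → s < m → r + 2 * s < 2 * m
r+2s<2m {r} {s} {m} r≤1 s<m = begin-strict
  r + 2 * s  <⟨ +-monoˡ-< (2 * s) (s≤s r≤1) ⟩
  2 + 2 * s  ≡⟨ solve (s ∷ []) ⟩
  2 * suc s  ≤⟨ *-monoʳ-≤ 2 s<m ⟩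
  2 * m      ∎
  where open ≤-Reasoning

[r+2x]%2m≡r+2[x%m] : ∀ m′ r x → let m = suc m′ in r ≤ 1 → (r + 2 * x) % (2 * m) ≡ r + 2 * (x % m)
[r+2x]%2m≡r+2[x%m] m′ r x r≤1 = begin
  (r + 2 * x) % (2 * m)                         ≡⟨ cong (λ z → (r + 2 * z) % (2 * m)) (m≡m%n+[m/n]*n x m) ⟩
  (r + 2 * (x % m + x / m * m)) % (2 * m)       ≡⟨ cong (_% (2 * m)) (regroup r (x % m) (x / m) m) ⟩
  (r + 2 * (x % m) + x / m * (2 * m)) % (2 * m) ≡⟨ [m+kn]%n≡m%n (r + 2 * (x % m)) (x / m) (2 * m) ⟩
  (r + 2 * (x % m)) % (2 * m)                   ≡⟨ m<n⇒m%n≡m (r+2s<2m r≤1 (m%n<n x m)) ⟩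
  r + 2 * (x % m)                               ∎
  where
  open ≡-Reasoning
  m : ℕ
  m = suc m′
  regroup : ∀ r s q m → r + 2 * (s + q * m) ≡ r + 2 * s + q * (2 * m)
  regroup = solve-∀

-- Congruences

-- An inductive relation rather than an equation between remainders: its indices can be
-- inferred by unification, and it needs no NonZero instance.
infix 4 _≡_mod_
data _≡_mod_ (a a' n : ℕ) : Set where
  shift : ∀ c c' → c * n + a ≡ c' * n + a' → a ≡ a' mod n

mod-refl : ∀ {a n} → a ≡ a mod n
mod-refl = shift 0 0 refl

mod-sym : ∀ {a a' n} → a ≡ a' mod n → a' ≡ a mod n
mod-sym (shift c c' eq) = shift c' c (sym eq)

mod-trans : ∀ {a a' a'' n} → a ≡ a' mod n → a' ≡ a'' mod n → a ≡ a'' mod n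
mod-trans {a} {a'} {a''} {n} (shift c c' eq) (shift d d' eq') = shift (d + c) (c' + d') (begin
  (d + c) * n + a         ≡⟨ regroup d c n a ⟩
  d * n + (c * n + a)     ≡⟨ cong (_+_ (d * n)) eq ⟩
  d * n + (c' * n + a')   ≡⟨ swap (d * n) (c' * n) a' ⟩
  c' * n + (d * n + a')   ≡⟨ cong (_+_ (c' * n)) eq' ⟩
  c' * n + (d' * n + a'') ≡⟨ regroup c' d' n a'' ⟨
  (c' + d') * n + a''     ∎)
  where
  open ≡-Reasoning
  regroup : ∀ x y n a → (x + y) * n + a ≡ x * n + (y * n + a)
  regroup = solve-∀
  swap : ∀ x y a → x + (y + a) ≡ y + (x + a)
  swap = solve-∀

mod-+-congˡ : ∀ {a a' n} e → a ≡ a' mod n → e + a ≡ e + a' mod n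
mod-+-congˡ {a} {a'} {n} e (shift c c' eq) = shift c c' (begin
  c * n + (e + a)   ≡⟨ swap (c * n) e a ⟩
  e + (c * n + a)   ≡⟨ cong (_+_ e) eq ⟩
  e + (c' * n + a') ≡⟨ swap (c' * n) e a' ⟨
  c' * n + (e + a') ∎)
  where
  open ≡-Reasoning
  swap : ∀ x e a → x + (e + a) ≡ e + (x + a)
  swap = solve-∀

mod-+-congʳ : ∀ {a a' n} e → a ≡ a' mod n → a + e ≡ a' + e mod n
mod-+-congʳ {a} {a'} {n} e (shift c c' eq) =
  shift c c' (trans (sym (+-assoc (c * n) a e)) (trans (cong (_+ e) eq) (+-assoc (c' * n) a' e)))

mod-*-congˡ : ∀ {a a' n} c → a ≡ a' mod n → c * a ≡ c * a' mod c * n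
mod-*-congˡ {a} {a'} {n} c (shift d d' eq) =
  shift d d' (trans (distrib d c n a) (trans (cong (c *_) eq) (sym (distrib d' c n a'))))
  where
  distrib : ∀ d c n a → d * (c * n) + c * a ≡ c * (d * n + a)
  distrib = solve-∀

n+a≡a : ∀ n a → n + a ≡ a mod n
n+a≡a n a = shift 0 1 (solve (n ∷ a ∷ []))

m+[m+a]≡a : ∀ m a → m + (m + a) ≡ a mod 2 * m
m+[m+a]≡a m a = shift 0 1 (solve (m ∷ a ∷ []))

mod⇒%≡ : ∀ {a a' n} .{{_ : NonZero n}} → a ≡ a' mod n → a % n ≡ a' % n
mod⇒%≡ {a} {a'} {n} (shift c c' eq) = begin
  a % n             ≡⟨ [m+kn]%n≡m%n a c n ⟨
  (a + c * n) % n   ≡⟨ cong (_% n) (trans (+-comm a (c * n)) (trans eq (+-comm (c' * n) a'))) ⟩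
  (a' + c' * n) % n ≡⟨ [m+kn]%n≡m%n a' c' n ⟩
  a' % n            ∎
  where open ≡-Reasoning

a%n≡a-mod : ∀ a n .{{_ : NonZero n}} → a % n ≡ a mod n
a%n≡a-mod a n = shift (a / n) 0 (trans (+-comm (a / n * n) (a % n)) (sym (m≡m%n+[m/n]*n a n)))

toℕ-fromℕ<-mod : ∀ a n .{{_ : NonZero n}} → toℕ (fromℕ< (m%n<n a n)) ≡ a mod n
toℕ-fromℕ<-mod a n = subst (_≡ a mod n) (sym (toℕ-fromℕ< (m%n<n a n))) (a%n≡a-mod a n)

extendFromFin : ∀ {n} .{{_ : NonZero n}} (P : ℕ → ℕ → Set) →
                (∀ {a a' b b'} → a ≡ a' mod n → b ≡ b' mod n → P a b → P a' b') →
                (∀ (i j : Fin n) → P (toℕ i) (toℕ j)) → ∀ a b → P a b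
extendFromFin {n} P respects hyp a b =
  respects (toℕ-fromℕ<-mod a n) (toℕ-fromℕ<-mod b n) (hyp (fromℕ< (m%n<n a n)) (fromℕ< (m%n<n b n)))

x≡-x⇒x≡0 : ∀ {x} → x ≡ - x → x ≡ 0ℤ
x≡-x⇒x≡0 {+ zero}      _ = refl
x≡-x⇒x≡0 {+ suc _}     ()
x≡-x⇒x≡0 {ℤ.-[1+ _ ]} ()

[a-c]+[-d+b]≡0⇔a+b≡c+d : ∀ a b c d → (a - c) ℤ.+ (- d ℤ.+ b) ≡ 0ℤ ⇔ a ℤ.+ b ≡ c ℤ.+ d
[a-c]+[-d+b]≡0⇔a+b≡c+d a b c d = mk⇔
  (λ eq → ℤP.i-j≡0⇒i≡j _ _ (trans (regroup a b c d) eq))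
  (λ eq → trans (sym (regroup a b c d)) (ℤP.i≡j⇒i-j≡0 eq))
  where
  regroup : ∀ a b c d → (a ℤ.+ b) - (c ℤ.+ d) ≡ (a - c) ℤ.+ (- d ℤ.+ b)
  regroup = ℤ-Solver.solve-∀

nlab-injective : ∀ N (s t : Fin N) → nlab N s ≡ nlab N t → s ≡ t
nlab-injective N s t eq = toℕ-injective
  (*-cancelˡ-≡ (toℕ s) (toℕ t) 2 (+-cancelʳ-≡ 1 _ _ (ℤP.+-injective (∙-cancelʳ (- + N) _ _ eq))))

-- Periodic and antipodal functions on ℕ × ℕ

Periodic : ℕ → (ℕ → ℕ → ℤ) → Set
Periodic n f = ∀ {a a' b b'} → a ≡ a' mod n → b ≡ b' mod n → f a b ≡ f a' b'

Antipodal : ℕ → (ℕ → ℕ → ℤ) → Set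
Antipodal m f = ∀ a b → f (m + a) (m + b) ≡ - f a b

antipodal-mod : ∀ {n m f} → Periodic n f → Antipodal m f →
                ∀ {a b} a' b' → a ≡ m + a' mod n → b ≡ m + b' mod n → f a b ≡ - f a' b'
antipodal-mod per anti a' b' eqa eqb = trans (per eqa eqb) (anti a' b')

module _ {p : ℕ} (L : Table (suc p)) where

  at-cong : ∀ {a a' b b'} → a % suc p ≡ a' % suc p → b % suc p ≡ b' % suc p → at L a b ≡ at L a' b'
  at-cong eqa eqb = cong₂ L (fromℕ<-cong _ _ eqa _ _) (fromℕ<-cong _ _ eqb _ _)

  at-periodic : Periodic (suc p) (at L)
  at-periodic {a} {a'} {b} {b'} eqa eqb = at-cong {a} {a'} {b} {b'} (mod⇒%≡ eqa) (mod⇒%≡ eqb)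

  at-toℕ : ∀ i j → at L (toℕ i) (toℕ j) ≡ L i j
  at-toℕ i j = cong₂ L (index-toℕ i) (index-toℕ j)
    where
    index-toℕ : ∀ i → fromℕ< (m%n<n (toℕ i) (suc p)) ≡ i
    index-toℕ i = trans (fromℕ<-cong _ _ (m<n⇒m%n≡m (toℕ<n i)) _ (toℕ<n i)) (fromℕ<-toℕ i _)

  at-injectiveʳ : (∀ i j i' j' → L i j ≡ L i' j' → (i ≡ i') × (j ≡ j')) →
                  ∀ a b a' b' → at L a b ≡ at L a' b' → b % suc p ≡ b' % suc p
  at-injectiveʳ inj a b a' b' eq = begin
    b % suc p       ≡⟨ toℕ-fromℕ< _ ⟨
    toℕ (index b)   ≡⟨ cong toℕ (proj₂ (inj (index a) (index b) (index a') (index b') eq)) ⟩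
    toℕ (index b')  ≡⟨ toℕ-fromℕ< _ ⟩
    b' % suc p      ∎
    where
    open ≡-Reasoning
    index : ℕ → Fin (suc p)
    index a = fromℕ< (m%n<n a (suc p))

-- Neighbour sums

-- Both concern the vertex (1 + a, 1 + b), so that no predecessor is needed: the sum over
-- its two lower neighbours, and over all four.
lowerNeighbourSum : (ℕ → ℕ → ℤ) → ℕ → ℕ → ℤ
lowerNeighbourSum f a b = f a (suc b) ℤ.+ f (suc a) b

neighbourSum : (ℕ → ℕ → ℤ) → ℕ → ℕ → ℤ
neighbourSum f a b = lowerNeighbourSum f a b ℤ.+ lowerNeighbourSum f (suc a) (suc b)

neighbourSum-periodic : ∀ {n f} → Periodic n f → Periodic n (neighbourSum f)
neighbourSum-periodic per eqa eqb = cong₂ ℤ._+_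
  (cong₂ ℤ._+_ (per eqa (mod-+-congˡ 1 eqb)) (per (mod-+-congˡ 1 eqa) eqb))
  (cong₂ ℤ._+_ (per (mod-+-congˡ 1 eqa) (mod-+-congˡ 2 eqb)) (per (mod-+-congˡ 2 eqa) (mod-+-congˡ 1 eqb)))

neighbourSum-antipodal : ∀ {m f} → Antipodal m f → Antipodal m (neighbourSum f)
neighbourSum-antipodal {m} {f} anti a b = begin
  neighbourSum f (m + a) (m + b)
    ≡⟨ cong₂ ℤ._+_
         (cong₂ ℤ._+_ (flip (m + a) (suc (m + b)) a (suc b) refl (+-suc m b))
                      (flip (suc (m + a)) (m + b) (suc a) b (+-suc m a) refl))
         (cong₂ ℤ._+_ (flip (suc (m + a)) (2 + (m + b)) (suc a) (2 + b) (+-suc m a) (solve (m ∷ b ∷ [])))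
                      (flip (2 + (m + a)) (suc (m + b)) (2 + a) (suc b) (solve (m ∷ a ∷ [])) (+-suc m b))) ⟩
  (- A ℤ.+ - B) ℤ.+ (- C ℤ.+ - D)
    ≡⟨ cong₂ ℤ._+_ (ℤP.neg-distrib-+ A B) (ℤP.neg-distrib-+ C D) ⟨
  - (A ℤ.+ B) ℤ.+ - (C ℤ.+ D)
    ≡⟨ ℤP.neg-distrib-+ (A ℤ.+ B) (C ℤ.+ D) ⟨
  - neighbourSum f a b ∎
  where
  open ≡-Reasoning
  A B C D : ℤ
  A = f a (suc b)
  B = f (suc a) b
  C = f (suc a) (2 + b)
  D = f (2 + a) (suc b)
  flip : ∀ a b a' b' → m + a' ≡ a → m + b' ≡ b → f a b ≡ - f a' b'
  flip a b a' b' refl refl = anti a' b'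

-- The last component of IsDistanceMagicLabeling, for a table of size suc p (so p stands for -1).
MagicCondition : ∀ {p} → Table (suc p) → Set
MagicCondition {p} L = ∀ (i j : Fin (suc p)) → let a = toℕ i ; b = toℕ j in
  at L (a + p) b ℤ.+ at L (a + 1) b ℤ.+ at L a (b + p) ℤ.+ at L a (b + 1) ≡ 0ℤ

neighbourSum-centred : ∀ {p f} → Periodic (suc p) f → ∀ a b →
  f (a + p) b ℤ.+ f (a + 1) b ℤ.+ f a (b + p) ℤ.+ f a (b + 1) ≡ neighbourSum f (a + p) (b + p)
neighbourSum-centred {p} {f} per a b = begin
  f (a + p) b ℤ.+ f (a + 1) b ℤ.+ f a (b + p) ℤ.+ f a (b + 1)
    ≡⟨ regroup (f (a + p) b) (f (a + 1) b) (f a (b + p)) (f a (b + 1)) ⟩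
  (f (a + p) b ℤ.+ f a (b + p)) ℤ.+ (f a (b + 1) ℤ.+ f (a + 1) b)
    ≡⟨ cong₂ ℤ._+_
         (cong₂ ℤ._+_ (per mod-refl (shift 1 0 (solve (b ∷ p ∷ []))))
                      (per (shift 1 0 (solve (a ∷ p ∷ []))) mod-refl))
         (cong₂ ℤ._+_ (per (shift 1 0 (solve (a ∷ p ∷ []))) (shift 1 0 (solve (b ∷ p ∷ []))))
                      (per (shift 1 0 (solve (a ∷ p ∷ []))) (shift 1 0 (solve (b ∷ p ∷ []))))) ⟩
  neighbourSum f (a + p) (b + p) ∎
  where
  open ≡-Reasoning
  regroup : ∀ w x y z → w ℤ.+ x ℤ.+ y ℤ.+ z ≡ (w ℤ.+ y) ℤ.+ (z ℤ.+ x)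
  regroup = ℤ-Solver.solve-∀

magicCondition⇔neighbourSums≡0 : ∀ {p} (L : Table (suc p)) →
                                 MagicCondition L ⇔ (∀ a b → neighbourSum (at L) a b ≡ 0ℤ)
magicCondition⇔neighbourSums≡0 {p} L =
  mk⇔ vanish (λ vanish i j → trans (neighbourSum-centred per (toℕ i) (toℕ j)) (vanish _ _))
  where
  per : Periodic (suc p) (at L)
  per = at-periodic L
  vanish : MagicCondition L → ∀ a b → neighbourSum (at L) a b ≡ 0ℤ
  vanish magic a b = trans
    (neighbourSum-periodic per {a' = suc a + p} {b' = suc b + p}
      (shift 1 0 (solve (a ∷ p ∷ []))) (shift 1 0 (solve (b ∷ p ∷ []))))
    (extendFromFin (λ a b → neighbourSum (at L) (a + p) (b + p) ≡ 0ℤ)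
      (λ eqa eqb → trans (neighbourSum-periodic per (mod-sym (mod-+-congʳ p eqa)) (mod-sym (mod-+-congʳ p eqb))))
      (λ i j → trans (sym (neighbourSum-centred per (toℕ i) (toℕ j))) (magic i j))
      (suc a) (suc b))

-- Counting

injective⇒surjective : ∀ {n} (h : Fin n → Fin n) → (∀ x y → h x ≡ h y → x ≡ y) →
                       ∀ y → ∃ λ x → h x ≡ y
injective⇒surjective {suc n} h h-inj y with any? (λ x → h x ≟ y)
... | yes hit = hit
... | no miss = contradiction (injective⇒≤ {f = h′} h′-inj) 1+n≰n
  where
  y≢h : ∀ x → y ≢ h x
  y≢h x y≡hx = miss (x , sym y≡hx)
  h′ : Fin (suc n) → Fin n
  h′ x = punchOut (y≢h x)
  h′-inj : ∀ {x x'} → h′ x ≡ h′ x' → x ≡ x'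
  h′-inj {x} {x'} eq = h-inj x x' (punchOut-injective (y≢h x) (y≢h x') eq)

covering-table⇒bijective : ∀ {n N} (L : Table n) (v : Fin N → ℤ) → N ≡ n * n →
  (∀ s t → v s ≡ v t → s ≡ t) → (∀ t → ∃₂ λ i j → L i j ≡ v t) →
  (∀ i j → ∃ λ t → L i j ≡ v t) × (∀ i j i' j' → L i j ≡ L i' j' → (i ≡ i') × (j ≡ j'))
covering-table⇒bijective {n} L v refl v-inj covers = entries , injective
  where
  row col : Fin (n * n) → Fin n
  row t = proj₁ (covers t)
  col t = proj₁ (proj₂ (covers t))
  covers-at : ∀ t → L (row t) (col t) ≡ v t
  covers-at t = proj₂ (proj₂ (covers t))
  position-injective : ∀ s t → combine (row s) (col s) ≡ combine (row t) (col t) → s ≡ t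
  position-injective s t eq with combine-injective (row s) (col s) (row t) (col t) eq
  ... | row≡ , col≡ = v-inj s t (trans (sym (covers-at s)) (trans (cong₂ L row≡ col≡) (covers-at t)))
  preimage : ∀ i j → ∃ λ t → (row t ≡ i) × (col t ≡ j)
  preimage i j with t , eq ← injective⇒surjective _ position-injective (combine i j) =
    t , combine-injective (row t) (col t) i j eq
  entries : ∀ i j → ∃ λ t → L i j ≡ v t
  entries i j with t , refl , refl ← preimage i j = t , covers-at t
  injective : ∀ i j i' j' → L i j ≡ L i' j' → (i ≡ i') × (j ≡ j')
  injective i j i' j' eq with t , refl , refl ← preimage i j | t' , refl , refl ← preimage i' j'
    with refl ← v-inj t t' (trans (sym (covers-at t)) (trans eq (covers-at t'))) = refl , refl

-- Odd half-period m = 1 + 2k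

module _ (k : ℕ) where

  -- Inlined, so that the ring solver sees 1 + 2 * k.
  private
    m : ℕ
    m = 1 + 2 * k
    {-# INLINE m #-}

  lowerNeighbourSum-half-turn : ∀ {f} → (∀ a b → neighbourSum f a b ≡ 0ℤ) →
                                ∀ a b → lowerNeighbourSum f (m + a) (m + b) ≡ - lowerNeighbourSum f a b
  lowerNeighbourSum-half-turn {f} nb a b = trans (step (2 * k + a) (2 * k + b)) (cong -_ (double-steps k a b))
    where
    u : ℕ → ℕ → ℤ
    u = lowerNeighbourSum f

    step : ∀ a b → u (suc a) (suc b) ≡ - u a b
    step a b = inverseʳ-unique (u a b) _ (nb a b)

    double-steps : ∀ j a b → u (2 * j + a) (2 * j + b) ≡ u a b
    double-steps zero    a b = refl
    double-steps (suc j) a b = begin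
      u (2 * suc j + a) (2 * suc j + b)     ≡⟨ cong₂ u (solve (j ∷ a ∷ [])) (solve (j ∷ b ∷ [])) ⟩
      u (2 + (2 * j + a)) (2 + (2 * j + b)) ≡⟨ trans (step _ _) (cong -_ (step _ _)) ⟩
      - - u (2 * j + a) (2 * j + b)         ≡⟨ ℤP.neg-involutive _ ⟩
      u (2 * j + a) (2 * j + b)             ≡⟨ double-steps j a b ⟩
      u a b                                 ∎
      where open ≡-Reasoning

  -- v changes sign under the half-turn (a, b) ↦ (m + a, m + b), as the lower neighbour
  -- sums do, while periodicity makes v invariant under it.
  neighbourSums≡0⇒antipodal : ∀ {f} → Periodic (2 * m) f → (∀ a b → neighbourSum f a b ≡ 0ℤ) →
                              Antipodal m f
  neighbourSums≡0⇒antipodal {f} per nb a b =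
    inverseʳ-unique (f a b) _ (x≡-x⇒x≡0 (trans (sym (v-half-turn-fixes a b)) (v-half-turn a b)))
    where
    u : ℕ → ℕ → ℤ
    u = lowerNeighbourSum f

    v : ℕ → ℕ → ℤ
    v a b = f a b ℤ.+ f (m + a) (m + b)

    v-step : ∀ a b → v (suc a) b ≡ - v a (suc b)
    v-step a b = inverseʳ-unique (v a (suc b)) _ (begin
      v a (suc b) ℤ.+ v (suc a) b
        ≡⟨ interchange (f a (suc b)) (f (m + a) (m + suc b)) (f (suc a) b) (f (m + suc a) (m + b)) ⟩
      u a b ℤ.+ (f (m + a) (m + suc b) ℤ.+ f (m + suc a) (m + b))
        ≡⟨ cong (ℤ._+_ (u a b))
             (cong₂ ℤ._+_ (cong (f (m + a)) (+-suc m b)) (cong (λ c → f c (m + b)) (+-suc m a))) ⟩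
      u a b ℤ.+ u (m + a) (m + b)
        ≡⟨ cong (ℤ._+_ (u a b)) (lowerNeighbourSum-half-turn {f} nb a b) ⟩
      u a b ℤ.+ - u a b
        ≡⟨ ℤP.+-inverseʳ (u a b) ⟩
      0ℤ ∎)
      where open ≡-Reasoning

    v-double-steps : ∀ j a b → v (2 * j + a) b ≡ v a (2 * j + b)
    v-double-steps zero    a b = refl
    v-double-steps (suc j) a b = begin
      v (2 * suc j + a) b       ≡⟨ cong (λ c → v c b) (solve (j ∷ a ∷ [])) ⟩
      v (2 + (2 * j + a)) b     ≡⟨ trans (v-step _ _) (cong -_ (v-step _ _)) ⟩
      - - v (2 * j + a) (2 + b) ≡⟨ ℤP.neg-involutive _ ⟩
      v (2 * j + a) (2 + b)     ≡⟨ v-double-steps j a (2 + b) ⟩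
      v a (2 * j + (2 + b))     ≡⟨ cong (v a) (solve (j ∷ b ∷ [])) ⟩
      v a (2 * suc j + b)       ∎
      where open ≡-Reasoning

    v-half-turn : ∀ a b → v (m + a) (m + b) ≡ - v a b
    v-half-turn a b = begin
      v (suc (2 * k + a)) (m + b)     ≡⟨ v-step (2 * k + a) (m + b) ⟩
      - v (2 * k + a) (2 + 2 * k + b) ≡⟨ cong -_ (v-double-steps k a (2 + 2 * k + b)) ⟩
      - v a (2 * k + (2 + 2 * k + b)) ≡⟨ cong -_ (cong₂ ℤ._+_ (per mod-refl period)
                                                               (per mod-refl (mod-+-congˡ m period))) ⟩
      - v a b                         ∎
      where
      open ≡-Reasoning
      period : 2 * k + (2 + 2 * k + b) ≡ b mod 2 * m
      period = shift 0 1 (solve (k ∷ b ∷ []))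

    v-half-turn-fixes : ∀ a b → v (m + a) (m + b) ≡ v a b
    v-half-turn-fixes a b =
      trans (cong (ℤ._+_ (f (m + a) (m + b))) (per (m+[m+a]≡a m a) (m+[m+a]≡a m b)))
            (ℤP.+-comm (f (m + a) (m + b)) (f a b))

  antipodal-from-odd-columns : ∀ {f} → Periodic (2 * m) f →
    (∀ a y → f (m + a) (m + (1 + 2 * y)) ≡ - f a (1 + 2 * y)) → Antipodal m f
  antipodal-from-odd-columns {f} per odd-anti a b with parity b
  ... | odd y  = odd-anti a y
  ... | even y = begin
    f (m + a) (m + 2 * y)                     ≡⟨ cong (f (m + a)) ([1+2k]+2y≡1+2[k+y] k y) ⟩
    f (m + a) (1 + 2 * (k + y))               ≡⟨ ℤP.neg-involutive _ ⟨
    - - f (m + a) (1 + 2 * (k + y))           ≡⟨ cong -_ (odd-anti (m + a) (k + y)) ⟨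
    - f (m + (m + a)) (m + (1 + 2 * (k + y))) ≡⟨ cong -_ (per (m+[m+a]≡a m a) column) ⟩
    - f a (2 * y)                             ∎
    where
    open ≡-Reasoning
    column : m + (1 + 2 * (k + y)) ≡ 2 * y mod 2 * m
    column = mod-trans (shift 0 0 (cong (_+_ m) (sym ([1+2k]+2y≡1+2[k+y] k y)))) (m+[m+a]≡a m (2 * y))

  Rhombus : (ℕ → ℕ → ℤ) → ℕ → ℕ → Set
  Rhombus g x y = g (x + 2 * k) y ℤ.+ g x y ≡ g (x + k) (y + k) ℤ.+ g (x + k) (y + suc k)

  parTable : ℕ → (ℕ → ℕ → ℤ) → ℕ → ℕ → ℤ
  parTable r f x y = f (r + 2 * x) (2 * y)

  -- Replacing the two vertical neighbours by minus their antipodes turns the neighbour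
  -- sum into the defect of the rhombus condition on a table of par.
  neighbourSum≡0⇔rhombus : ∀ {f} → Periodic (2 * m) f → Antipodal m f → ∀ r x y →
    neighbourSum f (r + 2 * x) (1 + 2 * y) ≡ 0ℤ ⇔ Rhombus (parTable r f) (suc x) (suc y)
  neighbourSum≡0⇔rhombus {f} per anti r x y =
    subst (λ s → s ≡ 0ℤ ⇔ Rhombus g (suc x) (suc y)) (sym expand) ([a-c]+[-d+b]≡0⇔a+b≡c+d A B C D)
    where
    g : ℕ → ℕ → ℤ
    g = parTable r f
    A B C D : ℤ
    A = g (suc x + 2 * k) (suc y)
    B = g (suc x) (suc y)
    C = g (suc x + k) (suc y + k)
    D = g (suc x + k) (suc y + suc k)
    expand : neighbourSum f (r + 2 * x) (1 + 2 * y) ≡ (A - C) ℤ.+ (- D ℤ.+ B)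
    expand = cong₂ ℤ._+_
      (cong₂ ℤ._+_
        (per (shift 1 0 (solve (x ∷ r ∷ k ∷ []))) (shift 0 0 (solve (y ∷ []))))
        (antipodal-mod per anti _ _ (shift 1 0 (solve (x ∷ r ∷ k ∷ []))) (shift 1 0 (solve (y ∷ k ∷ [])))))
      (cong₂ ℤ._+_
        (antipodal-mod per anti _ _ (shift 1 0 (solve (x ∷ r ∷ k ∷ []))) (shift 1 0 (solve (y ∷ k ∷ []))))
        (cong₂ f (solve (x ∷ r ∷ [])) (solve (y ∷ []))))

  parTable-periodic : ∀ {f} r → Periodic (2 * m) f → Periodic m (parTable r f)
  parTable-periodic r per eqx eqy = per (mod-+-congˡ r (mod-*-congˡ 2 eqx)) (mod-*-congˡ 2 eqy)

  rhombus-periodic : ∀ {g} → Periodic m g → ∀ {x x' y y'} → x ≡ x' mod m → y ≡ y' mod m →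
                     Rhombus g x y → Rhombus g x' y'
  rhombus-periodic per eqx eqy rh = begin
    _ ≡⟨ cong₂ ℤ._+_ (per (mod-sym (mod-+-congʳ (2 * k) eqx)) (mod-sym eqy))
                     (per (mod-sym eqx) (mod-sym eqy)) ⟩
    _ ≡⟨ rh ⟩
    _ ≡⟨ cong₂ ℤ._+_ (per (mod-+-congʳ k eqx) (mod-+-congʳ k eqy))
                     (per (mod-+-congʳ k eqx) (mod-+-congʳ (suc k) eqy)) ⟩
    _ ∎
    where open ≡-Reasoning

  rhombus-cong : ∀ {g h} → (∀ x y → g x y ≡ h x y) → ∀ x y → Rhombus g x y → Rhombus h x y
  rhombus-cong g≗h x y rh = begin
    _ ≡⟨ cong₂ ℤ._+_ (g≗h (x + 2 * k) y) (g≗h x y) ⟨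
    _ ≡⟨ rh ⟩
    _ ≡⟨ cong₂ ℤ._+_ (g≗h (x + k) (y + k)) (g≗h (x + k) (y + suc k)) ⟩
    _ ∎
    where open ≡-Reasoning

  -- The condition that IsDistanceMagicPair imposes on each table, at (x, y).
  PairConditionAt : (ℕ → ℕ → ℤ) → ℕ → ℕ → Set
  PairConditionAt g x y =
    g (x + (m ∸ 1)) y ℤ.+ g x y ≡
    g (x + (m ∸ 1) / 2) (y + (m ∸ 1) / 2) ℤ.+ g (x + (m ∸ 1) / 2) (y + (m + 1) / 2)

  PairCondition : Table m → Set
  PairCondition U = ∀ (i j : Fin m) → PairConditionAt (at U) (toℕ i) (toℕ j)

  rhombus⇔pairConditionAt : ∀ g x y → Rhombus g x y ⇔ PairConditionAt g x y
  rhombus⇔pairConditionAt g x y =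
    subst₂ (λ h h' → Rhombus g x y ⇔
                     (g (x + 2 * k) y ℤ.+ g x y ≡ g (x + h) (y + h) ℤ.+ g (x + h) (y + h')))
           (sym (a≡2x⇒a/2≡x k refl)) (sym (a≡2x⇒a/2≡x {m + 1} (suc k) (solve (k ∷ [])))) (mk⇔ id id)

  pairCondition⇒rhombus : ∀ (U : Table m) → PairCondition U → ∀ x y → Rhombus (at U) x y
  pairCondition⇒rhombus U cond = extendFromFin (Rhombus (at U)) (rhombus-periodic (at-periodic U))
    (λ i j → Equivalence.from (rhombus⇔pairConditionAt (at U) (toℕ i) (toℕ j)) (cond i j))

  ExactlyOneSignAppears : Table m → Table m → Set
  ExactlyOneSignAppears T T' = ∀ v → InN (4 * (m * m)) v →
    (Appears T T' v ⊎ Appears T T' (- v)) × ¬ (Appears T T' v × Appears T T' (- v))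

  merEntry-even-even : ∀ (T T' : Table m) x y → merEntry m T T' (2 * x) (2 * y) ≡ at T x y
  merEntry-even-even T T' x y rewrite 2x%2≡0 x | 2x%2≡0 y =
    cong₂ (at T) (a≡2x⇒a/2≡x x refl) (a≡2x⇒a/2≡x y refl)

  merEntry-odd-even : ∀ (T T' : Table m) x y → merEntry m T T' (1 + 2 * x) (2 * y) ≡ at T' x y
  merEntry-odd-even T T' x y rewrite [1+2x]%2≡1 x | 2x%2≡0 y =
    cong₂ (at T') (a≡2x⇒a/2≡x x refl) (a≡2x⇒a/2≡x y refl)

  merEntry-odd-odd : ∀ (T T' : Table m) x y →
                     merEntry m T T' (1 + 2 * x) (1 + 2 * y) ≡ - at T (1 + k + x) (1 + k + y)
  merEntry-odd-odd T T' x y rewrite [1+2x]%2≡1 x | [1+2x]%2≡1 y =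
    cong -_ (cong₂ (at T) (a≡2x⇒a/2≡x (1 + k + x) (odd+m x)) (a≡2x⇒a/2≡x (1 + k + y) (odd+m y)))
    where
    odd+m : ∀ x → 1 + 2 * x + m ≡ 2 * (1 + k + x)
    odd+m x = trans (+-comm (1 + 2 * x) m) ([1+2k]+[1+2y]≡2[1+k+y] k x)

  merEntry-even-odd : ∀ (T T' : Table m) x y →
                      merEntry m T T' (2 * x) (1 + 2 * y) ≡ - at T' (k + x) (1 + k + y)
  merEntry-even-odd T T' x y rewrite 2x%2≡0 x | [1+2x]%2≡1 y =
    cong -_ (cong₂ (at T') (a≡2x⇒a/2≡x (k + x) even+m∸1) (a≡2x⇒a/2≡x (1 + k + y) odd+m))
    where
    even+m∸1 : 2 * x + m ∸ 1 ≡ 2 * (k + x)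
    even+m∸1 = cong (_∸ 1) {x = 2 * x + m} {y = 1 + 2 * (k + x)} (solve (x ∷ k ∷ []))
    odd+m : 1 + 2 * y + m ≡ 2 * (1 + k + y)
    odd+m = trans (+-comm (1 + 2 * y) m) ([1+2k]+[1+2y]≡2[1+k+y] k y)

  at-mer : ∀ (T T' : Table m) a b → at (mer m T T') a b ≡ merEntry m T T' a b
  at-mer T T' a b =
    trans (cong₂ (merEntry m T T') (toℕ-fromℕ< (m%n<n a (2 * m))) (toℕ-fromℕ< (m%n<n b (2 * m))))
          (reduced a b)
    where
    reading-periodic : ∀ r s (G : ℕ → ℕ → ℤ) → Periodic m G → r ≤ 1 → s ≤ 1 →
      (∀ x y → merEntry m T T' (r + 2 * x) (s + 2 * y) ≡ G x y) → ∀ x y →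
      merEntry m T T' ((r + 2 * x) % (2 * m)) ((s + 2 * y) % (2 * m)) ≡ merEntry m T T' (r + 2 * x) (s + 2 * y)
    reading-periodic r s G G-periodic r≤1 s≤1 reading x y = begin
      merEntry m T T' ((r + 2 * x) % (2 * m)) ((s + 2 * y) % (2 * m))
        ≡⟨ cong₂ (merEntry m T T') ([r+2x]%2m≡r+2[x%m] (2 * k) r x r≤1)
                                   ([r+2x]%2m≡r+2[x%m] (2 * k) s y s≤1) ⟩
      merEntry m T T' (r + 2 * (x % m)) (s + 2 * (y % m))
        ≡⟨ reading (x % m) (y % m) ⟩
      G (x % m) (y % m)
        ≡⟨ G-periodic (a%n≡a-mod x m) (a%n≡a-mod y m) ⟩
      G x y
        ≡⟨ reading x y ⟨
      merEntry m T T' (r + 2 * x) (s + 2 * y) ∎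
      where open ≡-Reasoning
    reduced : ∀ a b → merEntry m T T' (a % (2 * m)) (b % (2 * m)) ≡ merEntry m T T' a b
    reduced a b with parity a | parity b
    ... | even x | even y =
      reading-periodic 0 0 (at T) (at-periodic T) z≤n z≤n (merEntry-even-even T T') x y
    ... | odd x  | even y =
      reading-periodic 1 0 (at T') (at-periodic T') (s≤s z≤n) z≤n (merEntry-odd-even T T') x y
    ... | odd x  | odd y  = reading-periodic 1 1 (λ x y → - at T (1 + k + x) (1 + k + y))
      (λ eqx eqy → cong -_ (at-periodic T (mod-+-congˡ (1 + k) eqx) (mod-+-congˡ (1 + k) eqy)))
      (s≤s z≤n) (s≤s z≤n) (merEntry-odd-odd T T') x y
    ... | even x | odd y  = reading-periodic 0 1 (λ x y → - at T' (k + x) (1 + k + y))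
      (λ eqx eqy → cong -_ (at-periodic T' (mod-+-congˡ k eqx) (mod-+-congˡ (1 + k) eqy)))
      z≤n (s≤s z≤n) (merEntry-even-odd T T') x y

  module FromLabeling (L : Table (2 * m))
                      (inj : ∀ i j i' j' → L i j ≡ L i' j' → (i ≡ i') × (j ≡ j'))
                      (surj : ∀ v → InN (4 * (m * m)) v → ∃₂ λ i j → L i j ≡ v)
                      (magic : MagicCondition L) where

    f : ℕ → ℕ → ℤ
    f = at L

    per : Periodic (2 * m) f
    per = at-periodic L

    anti : Antipodal m f
    anti = neighbourSums≡0⇒antipodal per (Equivalence.to (magicCondition⇔neighbourSums≡0 L) magic)

    T T' : Table m
    T  = proj₁ (par m L)
    T' = proj₂ (par m L)

    2*index≡2x : ∀ x → 2 * toℕ (fromℕ< (m%n<n x m)) ≡ 2 * x mod 2 * m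
    2*index≡2x x = mod-*-congˡ 2 (toℕ-fromℕ<-mod x m)

    T≗parTable₀ : ∀ x y → at T x y ≡ parTable 0 f x y
    T≗parTable₀ x y = per (2*index≡2x x) (2*index≡2x y)

    T'≗parTable₁ : ∀ x y → at T' x y ≡ parTable 1 f x y
    T'≗parTable₁ x y = per (mod-trans (mod-+-congʳ 1 (2*index≡2x x)) (shift 0 0 (+-comm _ 1))) (2*index≡2x y)

    parTable-rhombus : ∀ r x y → Rhombus (parTable r f) x y
    parTable-rhombus r x y = rhombus-periodic (parTable-periodic r per) (n+a≡a m x) (n+a≡a m y)
      (Equivalence.to (neighbourSum≡0⇔rhombus per anti r (2 * k + x) (2 * k + y))
        (Equivalence.to (magicCondition⇔neighbourSums≡0 L) magic _ _))

    pairCondition : ∀ (U : Table m) r → (∀ x y → at U x y ≡ parTable r f x y) → PairCondition U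
    pairCondition U r U≗parTable i j = Equivalence.to (rhombus⇔pairConditionAt (at U) (toℕ i) (toℕ j))
      (rhombus-cong (λ x y → sym (U≗parTable x y)) (toℕ i) (toℕ j) (parTable-rhombus r (toℕ i) (toℕ j)))

    even-column-appears : ∀ a y → Appears T T' (f a (2 * y))
    even-column-appears a y with parity a
    ... | even x = inj₁ (fromℕ< (m%n<n x m) , fromℕ< (m%n<n y m) , T≗parTable₀ x y)
    ... | odd x  = inj₂ (fromℕ< (m%n<n x m) , fromℕ< (m%n<n y m) , T'≗parTable₁ x y)

    appears-in-even-column : ∀ {v} → Appears T T' v → ∃₂ λ a y → f a (2 * y) ≡ v
    appears-in-even-column (inj₁ (i , j , eq)) = 2 * toℕ i , toℕ j , eq
    appears-in-even-column (inj₂ (i , j , eq)) = 2 * toℕ i + 1 , toℕ j , eq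

    entry-or-negation-appears : ∀ {v} a b → f a b ≡ v → Appears T T' v ⊎ Appears T T' (- v)
    entry-or-negation-appears a b eq with parity b
    ... | even y = inj₁ (subst (Appears T T') eq (even-column-appears a y))
    ... | odd y  = inj₂ (subst (Appears T T') antipode (even-column-appears (m + a) (1 + k + y)))
      where
      antipode : f (m + a) (2 * (1 + k + y)) ≡ - _
      antipode = trans (cong (f (m + a)) (sym ([1+2k]+[1+2y]≡2[1+k+y] k y)))
                       (trans (anti a (1 + 2 * y)) (cong -_ eq))

    not-both-signs-appear : ∀ {v} → ¬ (Appears T T' v × Appears T T' (- v))
    not-both-signs-appear {v} (A , A⁻) with appears-in-even-column A | appears-in-even-column A⁻
    ... | a , y , eq | a' , y' , eq' = 2y%n≢[1+2z]%n (m∣m*n m) y (k + y')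
      (trans (at-injectiveʳ L inj a (2 * y) (m + a') (m + 2 * y') (trans eq (sym antipode)))
             (cong (_% (2 * m)) ([1+2k]+2y≡1+2[k+y] k y')))
      where
      antipode : f (m + a') (m + 2 * y') ≡ v
      antipode = trans (anti a' (2 * y')) (trans (cong -_ eq') (ℤP.neg-involutive v))

    exactlyOneSignAppears : ExactlyOneSignAppears T T'
    exactlyOneSignAppears v v∈𝒩 with i , j , eq ← surj v v∈𝒩 =
      entry-or-negation-appears (toℕ i) (toℕ j) (trans (at-toℕ L i j) eq) , not-both-signs-appear

    isDistanceMagicPair : IsDistanceMagicPair m T T'
    isDistanceMagicPair =
      exactlyOneSignAppears , pairCondition T 0 T≗parTable₀ , pairCondition T' 1 T'≗parTable₁

  module FromPair (T T' : Table m) (exactlyOne : ExactlyOneSignAppears T T')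
                  (cond : PairCondition T) (cond' : PairCondition T') where

    N : ℕ
    N = 4 * (m * m)

    M : Table (2 * m)
    M = mer m T T'

    f : ℕ → ℕ → ℤ
    f = at M

    per : Periodic (2 * m) f
    per = at-periodic M

    f-even-even : ∀ x y → f (2 * x) (2 * y) ≡ at T x y
    f-even-even x y = trans (at-mer T T' (2 * x) (2 * y)) (merEntry-even-even T T' x y)

    f-odd-even : ∀ x y → f (1 + 2 * x) (2 * y) ≡ at T' x y
    f-odd-even x y = trans (at-mer T T' (1 + 2 * x) (2 * y)) (merEntry-odd-even T T' x y)

    f-odd-odd : ∀ x y → f (1 + 2 * x) (1 + 2 * y) ≡ - at T (1 + k + x) (1 + k + y)
    f-odd-odd x y = trans (at-mer T T' (1 + 2 * x) (1 + 2 * y)) (merEntry-odd-odd T T' x y)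

    f-even-odd : ∀ x y → f (2 * x) (1 + 2 * y) ≡ - at T' (k + x) (1 + k + y)
    f-even-odd x y = trans (at-mer T T' (2 * x) (1 + 2 * y)) (merEntry-even-odd T T' x y)

    odd-columns-antipodal : ∀ a y → f (m + a) (m + (1 + 2 * y)) ≡ - f a (1 + 2 * y)
    odd-columns-antipodal a y with parity a
    ... | even x = begin
      f (m + 2 * x) (m + (1 + 2 * y))
        ≡⟨ cong₂ f ([1+2k]+2y≡1+2[k+y] k x) ([1+2k]+[1+2y]≡2[1+k+y] k y) ⟩
      f (1 + 2 * (k + x)) (2 * (1 + k + y))
        ≡⟨ f-odd-even (k + x) (1 + k + y) ⟩
      at T' (k + x) (1 + k + y)
        ≡⟨ ℤP.neg-involutive _ ⟨
      - - at T' (k + x) (1 + k + y)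
        ≡⟨ cong -_ (f-even-odd x y) ⟨
      - f (2 * x) (1 + 2 * y) ∎
      where open ≡-Reasoning
    ... | odd x = begin
      f (m + (1 + 2 * x)) (m + (1 + 2 * y))
        ≡⟨ cong₂ f ([1+2k]+[1+2y]≡2[1+k+y] k x) ([1+2k]+[1+2y]≡2[1+k+y] k y) ⟩
      f (2 * (1 + k + x)) (2 * (1 + k + y))
        ≡⟨ f-even-even (1 + k + x) (1 + k + y) ⟩
      at T (1 + k + x) (1 + k + y)
        ≡⟨ ℤP.neg-involutive _ ⟨
      - - at T (1 + k + x) (1 + k + y)
        ≡⟨ cong -_ (f-odd-odd x y) ⟨
      - f (1 + 2 * x) (1 + 2 * y) ∎
      where open ≡-Reasoning

    anti : Antipodal m f
    anti = antipodal-from-odd-columns per odd-columns-antipodal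

    parTable-rhombus : ∀ r (U : Table m) → (∀ x y → parTable r f x y ≡ at U x y) → PairCondition U →
                       ∀ x y → Rhombus (parTable r f) x y
    parTable-rhombus r U parTable≗U cond x y =
      rhombus-cong (λ x y → sym (parTable≗U x y)) x y (pairCondition⇒rhombus U cond x y)

    odd-column-neighbourSum≡0 : ∀ a y → neighbourSum f a (1 + 2 * y) ≡ 0ℤ
    odd-column-neighbourSum≡0 a y with parity a
    ... | even x = Equivalence.from (neighbourSum≡0⇔rhombus per anti 0 x y)
      (parTable-rhombus 0 T f-even-even cond (suc x) (suc y))
    ... | odd x  = Equivalence.from (neighbourSum≡0⇔rhombus per anti 1 x y)
      (parTable-rhombus 1 T' f-odd-even cond' (suc x) (suc y))

    neighbourSum≡0 : ∀ a b → neighbourSum f a b ≡ 0ℤ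
    neighbourSum≡0 a b with parity b
    ... | odd y  = odd-column-neighbourSum≡0 a y
    ... | even y = ℤP.neg-injective (begin
      - neighbourSum f a (2 * y)               ≡⟨ neighbourSum-antipodal {m} {f} anti a (2 * y) ⟨
      neighbourSum f (m + a) (m + 2 * y)       ≡⟨ cong (neighbourSum f (m + a)) ([1+2k]+2y≡1+2[k+y] k y) ⟩
      neighbourSum f (m + a) (1 + 2 * (k + y)) ≡⟨ odd-column-neighbourSum≡0 (m + a) (k + y) ⟩
      0ℤ                                       ∎)
      where open ≡-Reasoning

    appears⇒entry : ∀ {v} → Appears T T' v → ∃₂ λ a b → f a b ≡ v
    appears⇒entry (inj₁ (i , j , eq)) =
      2 * toℕ i , 2 * toℕ j , trans (f-even-even (toℕ i) (toℕ j)) (trans (at-toℕ T i j) eq)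
    appears⇒entry (inj₂ (i , j , eq)) =
      1 + 2 * toℕ i , 2 * toℕ j , trans (f-odd-even (toℕ i) (toℕ j)) (trans (at-toℕ T' i j) eq)

    index : ℕ → Fin (2 * m)
    index a = fromℕ< (m%n<n a (2 * m))

    covers : ∀ t → ∃₂ λ i j → M i j ≡ nlab N t
    covers t with proj₁ (exactlyOne (nlab N t) (t , refl))
    ... | inj₁ A with a , b , eq ← appears⇒entry A = index a , index b , eq
    ... | inj₂ A⁻ with a , b , eq ← appears⇒entry A⁻ =
      index (m + a) , index (m + b) , trans (anti a b) (trans (cong -_ eq) (ℤP.neg-involutive _))

    bijective : (∀ i j → InN N (M i j)) × (∀ i j i' j' → M i j ≡ M i' j' → (i ≡ i') × (j ≡ j'))
    bijective = covering-table⇒bijective M (nlab N) (4[m*m]≡2m*2m m) (nlab-injective N) covers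

    isDistanceMagicLabeling : IsDistanceMagicLabeling m M
    isDistanceMagicLabeling =
      proj₁ bijective , proj₂ bijective , (λ { v (t , refl) → covers t }) ,
      Equivalence.from (magicCondition⇔neighbourSums≡0 M) neighbourSum≡0

odd⇒1+2k : ∀ m → m % 2 ≡ 1 → ∃ λ k → m ≡ 1 + 2 * k
odd⇒1+2k m m%2≡1 = m / 2 , trans (m≡m%n+[m/n]*n m 2) (cong₂ _+_ m%2≡1 (*-comm (m / 2) 2))

lemma4p1 : (m : ℕ) → 3 ≤ m → m % 2 ≡ 1 →
    ((CCDistanceMagic m → (L : Table (2 * m)) → IsDistanceMagicLabeling m L →
        IsDistanceMagicPair m (proj₁ (par m L)) (proj₂ (par m L)))
    × ((T T' : Table m) → IsDistanceMagicPair m T T' →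
        IsDistanceMagicLabeling m (mer m T T') × CCDistanceMagic m))
lemma4p1 m _ m%2≡1 with k , refl ← odd⇒1+2k m m%2≡1 =
  (λ _ L (_ , inj , surj , magic) → FromLabeling.isDistanceMagicPair k L inj surj magic) ,
  (λ T T' (exactlyOne , cond , cond') → let open FromPair k T T' exactlyOne cond cond' in
     isDistanceMagicLabeling , (M , isDistanceMagicLabeling))
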